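{- Let $B\subseteq A$. The natural injection $B^*\to A^*$ induces an injective monoid homomorphism $\mathrm{Styl}(B)\to\mathrm{Styl}(A)$. In other words, for $u,v\in B^*$: $u\cdot\gamma=v\cdot\gamma$ for all columns $\gamma$ on $B$ if and only if $u\cdot\gamma=v\cdot\gamma$ for all columns $\gamma$ on $A$.
   Context: $A$ is a finite totally ordered alphabet and $B\subseteq A$ carries the induced order. For a totally ordered finite alphabet $C$, a column on $C$ is a subset of $C$. For a column $\gamma$ and a letter $x$: if $x>y$ for all $y\in\gamma$, $x\cdot\gamma=\gamma\cup\{x\}$; otherwise with $y$ the smallest element of $\gamma$ with $y\geq x$, $x\cdot\gamma=(\gamma\setminus\{y\})\cup\{x\}$; this extends to a left action of $C^*$ on columns on $C$ by $(uv)\cdot\gamma=u\cdot(v\cdot\gamma)$. $\mathrm{Styl}(C)$ is the monoid of maps on the set of columns on $C$ induced by words of $C^*$. -}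

module Defs where

open import Data.Nat using (ℕ)
open import Data.Fin using (Fin; _≤?_)
open import Data.Fin.Subset using (Subset; _∪_; _-_; ⁅_⁆)
open import Data.Fin.Subset.Properties using (_∈?_)
open import Data.List using (List; []; _∷_; filter; allFin)
open import Data.Maybe using (Maybe; just; nothing)
open import Relation.Nullary.Decidable using (_×-dec_)

-- A finite totally ordered alphabet with k letters is modelled as Fin k
-- with its natural order. A column on it is a subset: Subset k.

-- Smallest element y of γ with x ≤ y (if any). allFin k is increasing,
-- so the first element of the filtered list is the smallest one.
firstOf : ∀ {A : Set} → List A → Maybe A
firstOf []      = nothing
firstOf (a ∷ _) = just a

smallestGeq : ∀ {k} → Fin k → Subset k → Maybe (Fin k)
smallestGeq {k} x γ = firstOf (filter (λ y → (x ≤? y) ×-dec (y ∈? γ)) (allFin k))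

actLetter : ∀ {k} → Fin k → Subset k → Subset k
actLetter x γ with smallestGeq x γ
... | nothing = γ ∪ ⁅ x ⁆
... | just y  = (γ - y) ∪ ⁅ x ⁆

-- Left action of words: (uv)·γ = u·(v·γ), so the rightmost letter acts first.
act : ∀ {k} → List (Fin k) → Subset k → Subset k
act []      γ = γ
act (x ∷ u) γ = actLetter x (act u γ)

-- A column S is determined by its counting function N_S(t), the number of
-- letters i ∈ S with h i < t, for any strictly increasing h into ℕ.  A letter x
-- changes it only above h x, where N_{x·S}(t) = N_S(t) ⊔ (1 + N_S(h x)): the
-- letter x is either a new record below t or it bumps a letter already counted.
-- Iterating gives the max-plus formula
--   N_{u·S}(t) = max_{b ≤ t} (N_S(b) + λ_u(b, t)),
-- where λ_u(b, t) is the length of a longest strictly decreasing subsequence of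
-- h-values of u lying in [b, t); conversely λ_u(b, t) = N_{u·S}(t) − N_S(b)
-- (b ≤ t) for the initial segment S = {i | h i < b}.  So two words act alike on all columns
-- exactly when their statistics λ agree, and λ only sees the relative order of
-- the letters, which an order embedding B → A preserves.
module Submission where

open import Defs
open import Data.Nat as ℕ using (ℕ; zero; suc; _+_; _⊔_; _⊓_; _≤_; _<_; z≤n; s≤s; s≤s⁻¹; _≤?_; _<?_; _<ᵇ_)
open import Data.Nat.Properties
open import Algebra.Properties.CommutativeSemigroup +-commutativeSemigroup using (xy∙z≈zy∙x; xy∙z≈xz∙y)
open import Data.Bool.Properties using (T-≡)
open import Data.Fin as Fin using (Fin; zero; suc)
import Data.Fin.Properties as Finₚ
open import Data.Fin.Subset using (Subset; _∈_; _∉_; _∪_; _-_; ⁅_⁆; ⊤)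
open import Data.Fin.Subset.Properties
  using (_∈?_; ∈⊤; x∈p∪q⁺; x∈p∪q⁻; x∈⁅x⁆; x∈⁅y⁆⇒x≡y; p─q⊆p; x∈p∧x≢y⇒x∈p-y; ⊆-antisym)
open import Data.List using (List; []; _∷_; filter; tabulate; map)
open import Data.List.Properties using (map-∘)
open import Data.Maybe using (Maybe; just; nothing)
open import Data.Product using (_×_; _,_; proj₁; proj₂)
open import Data.Sum using (inj₁; inj₂; [_,_]′)
import Data.Vec as Vec
open import Data.Vec.Properties using (lookup∘tabulate; lookup⇒[]=; []=⇒lookup)
open import Function using (_∘_)
open import Function.Bundles using (_⇔_; mk⇔; Equivalence)
open import Relation.Binary.Core using (_Preserves_⟶_)
open import Relation.Binary.PropositionalEquality
open import Relation.Nullary using (¬_; Dec; yes; no; contradiction)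
open import Relation.Nullary.Decidable using (_×-dec_)

∑ : ∀ {k} → (Fin k → ℕ) → ℕ
∑ {zero}  f = 0
∑ {suc k} f = f zero + ∑ (f ∘ suc)

∑-cong : ∀ {k} {f g : Fin k → ℕ} → f ≗ g → ∑ f ≡ ∑ g
∑-cong {zero}  f≗g = refl
∑-cong {suc k} f≗g = cong₂ _+_ (f≗g zero) (∑-cong (f≗g ∘ suc))

∑-mono-≤ : ∀ {k} {f g : Fin k → ℕ} → (∀ i → f i ≤ g i) → ∑ f ≤ ∑ g
∑-mono-≤ {zero}  f≤g = z≤n
∑-mono-≤ {suc k} f≤g = +-mono-≤ (f≤g zero) (∑-mono-≤ (f≤g ∘ suc))

∑-mono-< : ∀ {k} {f g : Fin k → ℕ} (i : Fin k) → (∀ j → f j ≤ g j) → f i < g i → ∑ f < ∑ g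
∑-mono-< zero    f≤g fi<gi = +-mono-<-≤ fi<gi (∑-mono-≤ (f≤g ∘ suc))
∑-mono-< (suc i) f≤g fi<gi = +-mono-≤-< (f≤g zero) (∑-mono-< i (f≤g ∘ suc) fi<gi)

∑-exchange : ∀ {k} {f g : Fin k → ℕ} (i : Fin k) → (∀ j → j ≢ i → f j ≡ g j) →
             ∑ f + g i ≡ ∑ g + f i
∑-exchange {f = f} {g} zero f≡g
  rewrite ∑-cong {f = f ∘ suc} {g ∘ suc} (λ j → f≡g (suc j) λ ()) =
  xy∙z≈zy∙x (f zero) _ (g zero)
∑-exchange {f = f} {g} (suc i) f≡g = begin
  f zero + ∑ (f ∘ suc) + g (suc i)   ≡⟨ +-assoc (f zero) _ _ ⟩
  f zero + (∑ (f ∘ suc) + g (suc i)) ≡⟨ cong₂ _+_ (f≡g zero λ ()) (∑-exchange i λ j j≢i → f≡g (suc j) (j≢i ∘ Finₚ.suc-injective)) ⟩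
  g zero + (∑ (g ∘ suc) + f (suc i)) ≡⟨ +-assoc (g zero) _ _ ⟨
  g zero + ∑ (g ∘ suc) + f (suc i)   ∎
  where open ≡-Reasoning

⨆ : ℕ → (ℕ → ℕ) → ℕ
⨆ zero    f = f zero
⨆ (suc t) f = ⨆ t f ⊔ f (suc t)

syntax ⨆ t (λ b → e) = ⨆[ b ≤ t ] e

⨆-ub : ∀ (f : ℕ → ℕ) {b t} → b ≤ t → f b ≤ ⨆ t f
⨆-ub f {t = zero}  z≤n = ≤-refl
⨆-ub f {t = suc t} b≤1+t with m≤n⇒m<n∨m≡n b≤1+t
... | inj₁ b<1+t = ≤-trans (⨆-ub f (s≤s⁻¹ b<1+t)) (m≤m⊔n _ _)
... | inj₂ refl  = m≤n⊔m _ _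

⨆-lub : ∀ (f : ℕ → ℕ) {t z} → (∀ b → b ≤ t → f b ≤ z) → ⨆ t f ≤ z
⨆-lub f {zero}  f≤z = f≤z 0 z≤n
⨆-lub f {suc t} f≤z = ⊔-lub (⨆-lub f λ b b≤t → f≤z b (m≤n⇒m≤1+n b≤t)) (f≤z (suc t) ≤-refl)

⨆-cong : ∀ t {f g : ℕ → ℕ} → f ≗ g → ⨆ t f ≡ ⨆ t g
⨆-cong zero    f≗g = f≗g 0
⨆-cong (suc t) f≗g = cong₂ _⊔_ (⨆-cong t f≗g) (f≗g (suc t))

⨆-suc : ∀ t (f : ℕ → ℕ) → suc (⨆ t f) ≡ ⨆[ b ≤ t ] suc (f b)
⨆-suc zero    f = refl
⨆-suc (suc t) f = cong (_⊔ suc (f (suc t))) (⨆-suc t f)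

𝟙 : ∀ {A : Set} → Dec A → ℕ
𝟙 (yes _) = 1
𝟙 (no  _) = 0

𝟙-yes : ∀ {A : Set} (a? : Dec A) → A → 𝟙 a? ≡ 1
𝟙-yes (yes _) _ = refl
𝟙-yes (no ¬a) a = contradiction a ¬a

𝟙-no : ∀ {A : Set} (a? : Dec A) → ¬ A → 𝟙 a? ≡ 0
𝟙-no (yes a) ¬a = contradiction a ¬a
𝟙-no (no  _) _  = refl

𝟙≡1⇒ : ∀ {A : Set} (a? : Dec A) → 𝟙 a? ≡ 1 → A
𝟙≡1⇒ (yes a) _ = a

𝟙-mono : ∀ {A B : Set} (a? : Dec A) (b? : Dec B) → (A → B) → 𝟙 a? ≤ 𝟙 b?
𝟙-mono (yes a) b? A→B = ≤-reflexive (sym (𝟙-yes b? (A→B a)))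
𝟙-mono (no  _) _  _   = z≤n

𝟙-cong : ∀ {A B : Set} (a? : Dec A) (b? : Dec B) → (A → B) → (B → A) → 𝟙 a? ≡ 𝟙 b?
𝟙-cong a? b? A→B B→A = ≤-antisym (𝟙-mono a? b? A→B) (𝟙-mono b? a? B→A)

-- lds xs lo hi is the length of a longest strictly decreasing subsequence of xs
-- all of whose entries lie in [lo, hi).
lds : List ℕ → ℕ → ℕ → ℕ
lds []       lo hi = 0
lds (x ∷ xs) lo hi with (lo ≤? x) ×-dec (x <? hi)
... | yes _ = lds xs lo hi ⊔ suc (lds xs lo x)
... | no  _ = lds xs lo hi

module _ {x lo hi : ℕ} (xs : List ℕ) where

  lds-∈ : lo ≤ x → x < hi → lds (x ∷ xs) lo hi ≡ lds xs lo hi ⊔ suc (lds xs lo x)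
  lds-∈ lo≤x x<hi with (lo ≤? x) ×-dec (x <? hi)
  ... | yes _ = refl
  ... | no x∉ = contradiction (lo≤x , x<hi) x∉

  lds-∉ : ¬ (lo ≤ x × x < hi) → lds (x ∷ xs) lo hi ≡ lds xs lo hi
  lds-∉ x∉ with (lo ≤? x) ×-dec (x <? hi)
  ... | yes x∈ = contradiction x∈ x∉
  ... | no  _  = refl

  lds-≤-∷ : lds xs lo hi ≤ lds (x ∷ xs) lo hi
  lds-≤-∷ with (lo ≤? x) ×-dec (x <? hi)
  ... | yes _ = m≤m⊔n _ _
  ... | no  _ = ≤-refl

lds-empty : ∀ xs {lo hi} → hi ≤ lo → lds xs lo hi ≡ 0
lds-empty []       hi≤lo = refl
lds-empty (x ∷ xs) hi≤lo =
  trans (lds-∉ xs λ (lo≤x , x<hi) → <-irrefl refl (<-≤-trans x<hi (≤-trans hi≤lo lo≤x)))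
        (lds-empty xs hi≤lo)

lds-antitone : ∀ xs {lo lo′ hi} → lo ≤ lo′ → lds xs lo′ hi ≤ lds xs lo hi
lds-antitone []       lo≤lo′ = z≤n
lds-antitone (x ∷ xs) {lo} {lo′} {hi} lo≤lo′ with (lo′ ≤? x) ×-dec (x <? hi)
... | yes (lo′≤x , x<hi) =
  ≤-trans (⊔-mono-≤ (lds-antitone xs lo≤lo′) (s≤s (lds-antitone xs lo≤lo′)))
          (≤-reflexive (sym (lds-∈ xs (≤-trans lo≤lo′ lo′≤x) x<hi)))
... | no _ = ≤-trans (lds-antitone xs lo≤lo′) (lds-≤-∷ xs)

module _ (c : ℕ → ℕ) (xs : List ℕ) {x t : ℕ} (x<t : x < t) where

  ⨆+lds-∷ : ⨆[ b ≤ t ] (c b + lds xs b t) ⊔ suc (⨆[ b ≤ x ] (c b + lds xs b x))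
          ≡ ⨆[ b ≤ t ] (c b + lds (x ∷ xs) b t)
  ⨆+lds-∷ = ≤-antisym upper lower
    where
    F G H : ℕ → ℕ
    F b = c b + lds xs b t
    G b = c b + lds xs b x
    H b = c b + lds (x ∷ xs) b t

    H≡F⊔sucG : ∀ {b} → b ≤ x → H b ≡ F b ⊔ suc (G b)
    H≡F⊔sucG {b} b≤x = begin
      c b + lds (x ∷ xs) b t                    ≡⟨ cong (c b +_) (lds-∈ xs b≤x x<t) ⟩
      c b + (lds xs b t ⊔ suc (lds xs b x))     ≡⟨ +-distribˡ-⊔ (c b) _ _ ⟩
      F b ⊔ (c b + suc (lds xs b x))            ≡⟨ cong (F b ⊔_) (+-suc (c b) _) ⟩
      F b ⊔ suc (G b)                           ∎
      where open ≡-Reasoning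

    H≡F : ∀ {b} → x < b → H b ≡ F b
    H≡F {b} x<b = cong (c b +_) (lds-∉ xs λ (b≤x , _) → <⇒≱ x<b b≤x)

    upper : ⨆ t F ⊔ suc (⨆ x G) ≤ ⨆ t H
    upper = ⊔-lub (⨆-lub F {t} λ b b≤t → ≤-trans (+-monoʳ-≤ (c b) (lds-≤-∷ xs)) (⨆-ub H b≤t))
                  (subst (_≤ ⨆ t H) (sym (⨆-suc x G)) (⨆-lub (ℕ.suc ∘ G) {x} λ b b≤x →
                    ≤-trans (≤-trans (m≤n⊔m (F b) _) (≤-reflexive (sym (H≡F⊔sucG b≤x))))
                            (⨆-ub H (≤-trans b≤x (<⇒≤ x<t)))))

    lower : ⨆ t H ≤ ⨆ t F ⊔ suc (⨆ x G)
    lower = ⨆-lub H {t} λ b b≤t →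
      [ (λ b≤x → ≤-trans (≤-reflexive (H≡F⊔sucG b≤x)) (⊔-mono-≤ (⨆-ub F b≤t) (s≤s (⨆-ub G b≤x))))
      , (λ x<b → ≤-trans (≤-reflexive (H≡F x<b)) (≤-trans (⨆-ub F b≤t) (m≤m⊔n _ _)))
      ]′ (≤-<-connex b x)

SameLds : List ℕ → List ℕ → Set
SameLds xs ys = ∀ lo hi → lds xs lo hi ≡ lds ys lo hi

data FirstIn {A : Set} {k} (P : A → Set) (f : Fin k → A) : Maybe A → Set where
  none  : (∀ j → ¬ P (f j)) → FirstIn P f nothing
  found : ∀ i → P (f i) → (∀ j → P (f j) → i Fin.≤ j) → FirstIn P f (just (f i))

firstOf-filter-tabulate : ∀ {A : Set} {P : A → Set} (P? : ∀ x → Dec (P x))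
  {k} (f : Fin k → A) → FirstIn P f (firstOf (filter P? (tabulate f)))
firstOf-filter-tabulate P? {zero}  f = none λ ()
firstOf-filter-tabulate P? {suc k} f with P? (f zero)
... | yes p = found zero p λ _ _ → z≤n
... | no ¬p with firstOf (filter P? (tabulate (f ∘ suc))) | firstOf-filter-tabulate P? (f ∘ suc)
...   | _ | none ¬P       = none λ { zero → ¬p ; (suc j) → ¬P j }
...   | _ | found i p min = found (suc i) p λ { zero q → contradiction q ¬p ; (suc j) q → s≤s (min j q) }

smallestGeq-first : ∀ {k} (x : Fin k) (S : Subset k) →
                    FirstIn (λ y → x Fin.≤ y × y ∈ S) (λ y → y) (smallestGeq x S)
smallestGeq-first x S = firstOf-filter-tabulate (λ y → (x Fin.≤? y) ×-dec (y ∈? S)) (λ y → y)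

y∉p-y : ∀ {k} (p : Subset k) y → y ∉ p - y
y∉p-y (_ Vec.∷ p) zero    ()
y∉p-y (_ Vec.∷ p) (suc y) (Vec.there y∈p-y) = y∉p-y p y y∈p-y

data LetterAction {k} (x : Fin k) (S : Subset k) : Subset k → Set where
  append : (∀ z → z ∈ S → z Fin.< x) → LetterAction x S (S ∪ ⁅ x ⁆)
  bump   : ∀ {y} → x Fin.≤ y → y ∈ S → (∀ z → x Fin.≤ z → z ∈ S → y Fin.≤ z) →
           x ∉ S - y → LetterAction x S ((S - y) ∪ ⁅ x ⁆)

actLetter-view : ∀ {k} (x : Fin k) (S : Subset k) → LetterAction x S (actLetter x S)
actLetter-view x S with smallestGeq x S | smallestGeq-first x S
... | _ | none ¬geq = append λ z z∈S → ≰⇒> λ x≤z → ¬geq z (x≤z , z∈S)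
... | _ | found y (x≤y , y∈S) least = bump x≤y y∈S least′ x∉S-y
  where
  least′ : ∀ z → x Fin.≤ z → z ∈ S → y Fin.≤ z
  least′ z x≤z z∈S = least z (x≤z , z∈S)
  x∉S-y : x ∉ S - y
  x∉S-y x∈S-y = y∉p-y S y (subst (_∈ S - y) (Finₚ.≤-antisym x≤y (least′ x ≤-refl (p─q⊆p S ⁅ y ⁆ x∈S-y))) x∈S-y)

SameAction : ∀ {k} → List (Fin k) → List (Fin k) → Set
SameAction u v = ∀ γ → act u γ ≡ act v γ

m≡n⇒m+1≡m⊔1+n : ∀ {m n} → m ≡ n → m + 1 ≡ m ⊔ suc n
m≡n⇒m+1≡m⊔1+n {m} refl = trans (+-comm m 1) (sym (m≤n⇒m⊔n≡n (n≤1+n m)))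

module Counting {k} (h : Fin k → ℕ) (h-increasing : h Preserves Fin._<_ ⟶ _<_) where

  h-mono-≤ : ∀ {i j} → i Fin.≤ j → h i ≤ h j
  h-mono-≤ i≤j with m≤n⇒m<n∨m≡n i≤j
  ... | inj₁ i<j = <⇒≤ (h-increasing i<j)
  ... | inj₂ i≡j = ≤-reflexive (cong h (Finₚ.toℕ-injective i≡j))

  h-cancel-≤ : ∀ {i j} → h i ≤ h j → i Fin.≤ j
  h-cancel-≤ {i} {j} hi≤hj with i Fin.≤? j
  ... | yes i≤j = i≤j
  ... | no  i≰j = contradiction hi≤hj (<⇒≱ (h-increasing (≰⇒> i≰j)))

  h-injective : ∀ {i j} → h i ≡ h j → i ≡ j
  h-injective hi≡hj = Finₚ.≤-antisym (h-cancel-≤ (≤-reflexive hi≡hj)) (h-cancel-≤ (≤-reflexive (sym hi≡hj)))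

  weight : Subset k → ℕ → Fin k → ℕ
  weight S t i = 𝟙 ((i ∈? S) ×-dec (h i <? t))

  count : Subset k → ℕ → ℕ
  count S t = ∑ (weight S t)

  rank : ℕ → ℕ
  rank = count ⊤

  below : ℕ → Subset k
  below b = Vec.tabulate λ i → h i <ᵇ b

  count-mono : ∀ S {t t′} → t ≤ t′ → count S t ≤ count S t′
  count-mono S {t} {t′} t≤t′ = ∑-mono-≤ pointwise
    where
    pointwise : ∀ i → weight S t i ≤ weight S t′ i
    pointwise i = 𝟙-mono _ _ λ (i∈S , hi<t) → i∈S , <-≤-trans hi<t t≤t′

  count-< : ∀ {S y t t′} → y ∈ S → t ≤ h y → h y < t′ → count S t < count S t′
  count-< {S} {y} {t} {t′} y∈S t≤hy hy<t′ = ∑-mono-< y (λ i → weight-mono i) weight-y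
    where
    weight-mono : ∀ i → weight S t i ≤ weight S t′ i
    weight-mono i = 𝟙-mono _ _ λ (i∈S , hi<t) → i∈S , <-trans hi<t (≤-<-trans t≤hy hy<t′)
    weight-y : weight S t y < weight S t′ y
    weight-y = subst₂ _<_ (sym (𝟙-no _ λ (_ , hy<t) → ≤⇒≯ t≤hy hy<t)) (sym (𝟙-yes _ (y∈S , hy<t′))) ≤-refl

  count-gap : ∀ {S t t′} → t ≤ t′ → (∀ z → z ∈ S → t ≤ h z → t′ ≤ h z) → count S t′ ≡ count S t
  count-gap {S} {t} {t′} t≤t′ gap = ∑-cong pointwise
    where
    pointwise : ∀ i → weight S t′ i ≡ weight S t i
    pointwise i = 𝟙-cong _ _
      (λ (i∈S , hi<t′) → i∈S , ≰⇒> λ t≤hi → <⇒≱ hi<t′ (gap i i∈S t≤hi))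
      (λ (i∈S , hi<t) → i∈S , <-≤-trans hi<t t≤t′)

  count-add : ∀ {S T y} t → y ∉ S → y ∈ T → (∀ j → j ≢ y → j ∈ S ⇔ j ∈ T) →
              count T t ≡ count S t + 𝟙 (h y <? t)
  count-add {S} {T} {y} t y∉S y∈T agree = begin
    count T t                 ≡⟨ +-identityʳ _ ⟨
    count T t + 0             ≡⟨ cong (count T t +_) (𝟙-no _ (y∉S ∘ proj₁)) ⟨
    count T t + weight S t y  ≡⟨ ∑-exchange y pointwise ⟨
    count S t + weight T t y  ≡⟨ cong (count S t +_) (𝟙-cong _ _ proj₂ (y∈T ,_)) ⟩
    count S t + 𝟙 (h y <? t)  ∎
    where
    open ≡-Reasoning
    open Equivalence
    pointwise : ∀ j → j ≢ y → weight S t j ≡ weight T t j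
    pointwise j j≢y = 𝟙-cong _ _ (λ (j∈S , hj<t) → to (agree j j≢y) j∈S , hj<t)
                                 (λ (j∈T , hj<t) → from (agree j j≢y) j∈T , hj<t)

  count-step : ∀ S i → count S (suc (h i)) ≡ count S (h i) + 𝟙 (i ∈? S)
  count-step S i = begin
    count S (suc (h i))                       ≡⟨ +-identityʳ _ ⟨
    count S (suc (h i)) + 0                   ≡⟨ cong (count S (suc (h i)) +_) (𝟙-no _ (<-irrefl refl ∘ proj₂)) ⟨
    count S (suc (h i)) + weight S (h i) i    ≡⟨ ∑-exchange i pointwise ⟨
    count S (h i) + weight S (suc (h i)) i    ≡⟨ cong (count S (h i) +_) (𝟙-cong _ _ proj₁ (_, ≤-refl)) ⟩
    count S (h i) + 𝟙 (i ∈? S)                ∎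
    where
    open ≡-Reasoning
    pointwise : ∀ j → j ≢ i → weight S (h i) j ≡ weight S (suc (h i)) j
    pointwise j j≢i = 𝟙-cong _ _ (λ (j∈S , hj<hi) → j∈S , m<n⇒m<1+n hj<hi)
                                 (λ (j∈S , hj≤hi) → j∈S , ≤∧≢⇒< (s≤s⁻¹ hj≤hi) (j≢i ∘ h-injective))

  count-injective : ∀ {S T} → (∀ t → count S t ≡ count T t) → S ≡ T
  count-injective S≗T = ⊆-antisym (⊆-from S≗T) (⊆-from (sym ∘ S≗T))
    where
    ⊆-from : ∀ {S T} → (∀ t → count S t ≡ count T t) → ∀ {i} → i ∈ S → i ∈ T
    ⊆-from {S} {T} S≗T {i} i∈S = 𝟙≡1⇒ (i ∈? T) (begin
      𝟙 (i ∈? T)  ≡⟨ +-cancelˡ-≡ (count T (h i)) _ _ (begin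
        count T (h i) + 𝟙 (i ∈? T)  ≡⟨ count-step T i ⟨
        count T (suc (h i))         ≡⟨ S≗T (suc (h i)) ⟨
        count S (suc (h i))         ≡⟨ count-step S i ⟩
        count S (h i) + 𝟙 (i ∈? S)  ≡⟨ cong (_+ 𝟙 (i ∈? S)) (S≗T (h i)) ⟩
        count T (h i) + 𝟙 (i ∈? S)  ∎) ⟩
      𝟙 (i ∈? S)  ≡⟨ 𝟙-yes (i ∈? S) i∈S ⟩
      1           ∎)
      where open ≡-Reasoning

  ∈-below⁺ : ∀ {i b} → h i < b → i ∈ below b
  ∈-below⁺ {i} {b} hi<b =
    lookup⇒[]= i (below b) (trans (lookup∘tabulate _ i) (Equivalence.to T-≡ (<⇒<ᵇ hi<b)))

  ∈-below⁻ : ∀ {i b} → i ∈ below b → h i < b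
  ∈-below⁻ {i} {b} i∈below =
    <ᵇ⇒< (h i) b (Equivalence.from T-≡ (trans (sym (lookup∘tabulate _ i)) ([]=⇒lookup i∈below)))

  count-below : ∀ b t → count (below b) t ≡ rank (t ⊓ b)
  count-below b t = ∑-cong pointwise
    where
    pointwise : ∀ i → weight (below b) t i ≡ weight ⊤ (t ⊓ b) i
    pointwise i = 𝟙-cong _ _
      (λ (i∈below , hi<t) → ∈⊤ , ⊓-pres-m< hi<t (∈-below⁻ i∈below))
      (λ (_ , hi<t⊓b) → ∈-below⁺ (<-≤-trans hi<t⊓b (m⊓n≤n t b)) , <-≤-trans hi<t⊓b (m⊓n≤m t b))

  rank-< : ∀ {x t} → h x < t → rank (h x) < rank t
  rank-< hx<t = count-< ∈⊤ ≤-refl hx<t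

  -- Raising lo to lo′ shortens a decreasing subsequence only by its entries in
  -- [lo, lo′), which are distinct letters, hence at most rank lo′ ∸ rank lo many.
  rank+lds-mono : ∀ u {lo lo′ hi} → lo ≤ lo′ →
                  rank lo + lds (map h u) lo hi ≤ rank lo′ + lds (map h u) lo′ hi
  rank+lds-mono []       lo≤lo′ = +-monoˡ-≤ 0 (count-mono ⊤ lo≤lo′)
  rank+lds-mono (x ∷ u) {lo} {lo′} {hi} lo≤lo′ with (lo ≤? h x) ×-dec (h x <? hi)
  ... | no _ = ≤-trans (rank+lds-mono u lo≤lo′) (+-monoʳ-≤ (rank lo′) (lds-≤-∷ (map h u)))
  ... | yes (lo≤hx , hx<hi) = begin
    rank lo + (L lo hi ⊔ suc (L lo (h x)))            ≡⟨ +-distribˡ-⊔ (rank lo) _ _ ⟩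
    (rank lo + L lo hi) ⊔ (rank lo + suc (L lo (h x))) ≤⟨ ⊔-lub
                                                           (≤-trans (rank+lds-mono u lo≤lo′) (+-monoʳ-≤ (rank lo′) (lds-≤-∷ (map h u))))
                                                           new-entry ⟩
    rank lo′ + lds (map h (x ∷ u)) lo′ hi              ∎
    where
    open ≤-Reasoning
    L : ℕ → ℕ → ℕ
    L = lds (map h u)
    new-entry : rank lo + suc (L lo (h x)) ≤ rank lo′ + lds (map h (x ∷ u)) lo′ hi
    new-entry with ≤-<-connex lo′ (h x)
    ... | inj₁ lo′≤hx = begin
      rank lo + suc (L lo (h x))     ≡⟨ +-suc _ _ ⟩
      suc (rank lo + L lo (h x))     ≤⟨ s≤s (rank+lds-mono u lo≤lo′) ⟩
      suc (rank lo′ + L lo′ (h x))   ≡⟨ +-suc _ _ ⟨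
      rank lo′ + suc (L lo′ (h x))   ≤⟨ +-monoʳ-≤ (rank lo′) (m≤n⊔m _ _) ⟩
      rank lo′ + (L lo′ hi ⊔ suc (L lo′ (h x))) ≡⟨ cong (rank lo′ +_) (lds-∈ (map h u) lo′≤hx hx<hi) ⟨
      rank lo′ + lds (map h (x ∷ u)) lo′ hi     ∎
    ... | inj₂ hx<lo′ = begin
      rank lo + suc (L lo (h x))         ≡⟨ +-suc _ _ ⟩
      suc (rank lo + L lo (h x))         ≤⟨ s≤s (rank+lds-mono u lo≤hx) ⟩
      suc (rank (h x) + L (h x) (h x))   ≡⟨ cong (λ l → suc (rank (h x) + l)) (lds-empty (map h u) ≤-refl) ⟩
      suc (rank (h x) + 0)               ≡⟨ cong suc (+-identityʳ _) ⟩
      suc (rank (h x))                   ≤⟨ rank-< hx<lo′ ⟩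
      rank lo′                           ≤⟨ m≤m+n _ _ ⟩
      rank lo′ + lds (map h (x ∷ u)) lo′ hi ∎

  count-insert : ∀ {S x} t → x ∉ S → count (S ∪ ⁅ x ⁆) t ≡ count S t + 𝟙 (h x <? t)
  count-insert {S} {x} t x∉S = count-add t x∉S (x∈p∪q⁺ (inj₂ (x∈⁅x⁆ x))) λ j j≢x →
    mk⇔ (λ j∈S → x∈p∪q⁺ (inj₁ j∈S))
        (λ j∈S∪x → [ (λ j∈S → j∈S) , (λ j∈x → contradiction (x∈⁅y⁆⇒x≡y x j∈x) j≢x) ]′ (x∈p∪q⁻ S ⁅ x ⁆ j∈S∪x))

  count-remove : ∀ {S y} t → y ∈ S → count S t ≡ count (S - y) t + 𝟙 (h y <? t)
  count-remove {S} {y} t y∈S = count-add t (y∉p-y S y) y∈S λ j j≢y →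
    mk⇔ (p─q⊆p S ⁅ y ⁆) (λ j∈S → x∈p∧x≢y⇒x∈p-y j∈S j≢y)

  count-bump : ∀ {S x y} t → y ∈ S → x ∉ S - y →
               count ((S - y) ∪ ⁅ x ⁆) t + 𝟙 (h y <? t) ≡ count S t + 𝟙 (h x <? t)
  count-bump {S} {x} {y} t y∈S x∉S-y = begin
    count ((S - y) ∪ ⁅ x ⁆) t + 𝟙 (h y <? t)             ≡⟨ cong (_+ 𝟙 (h y <? t)) (count-insert t x∉S-y) ⟩
    count (S - y) t + 𝟙 (h x <? t) + 𝟙 (h y <? t)        ≡⟨ xy∙z≈xz∙y (count (S - y) t) _ _ ⟩
    count (S - y) t + 𝟙 (h y <? t) + 𝟙 (h x <? t)        ≡⟨ cong (_+ 𝟙 (h x <? t)) (count-remove t y∈S) ⟨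
    count S t + 𝟙 (h x <? t)                             ∎
    where open ≡-Reasoning

  count-actLetter-≥ : ∀ x S {t} → t ≤ h x → count (actLetter x S) t ≡ count S t
  count-actLetter-≥ x S {t} t≤hx with actLetter x S | actLetter-view x S
  ... | _ | append smaller = begin
    count (S ∪ ⁅ x ⁆) t       ≡⟨ count-insert t (λ x∈S → <-irrefl refl (smaller x x∈S)) ⟩
    count S t + 𝟙 (h x <? t)  ≡⟨ cong (count S t +_) (𝟙-no _ (≤⇒≯ t≤hx)) ⟩
    count S t + 0             ≡⟨ +-identityʳ _ ⟩
    count S t                 ∎
    where open ≡-Reasoning
  ... | _ | bump {y} x≤y y∈S _ x∉S-y = +-cancelʳ-≡ _ _ _ (begin
    count ((S - y) ∪ ⁅ x ⁆) t + 0  ≡⟨ cong (count ((S - y) ∪ ⁅ x ⁆) t +_) (𝟙-no _ (≤⇒≯ (≤-trans t≤hx (h-mono-≤ x≤y)))) ⟨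
    count ((S - y) ∪ ⁅ x ⁆) t + 𝟙 (h y <? t)  ≡⟨ count-bump t y∈S x∉S-y ⟩
    count S t + 𝟙 (h x <? t)       ≡⟨ cong (count S t +_) (𝟙-no _ (≤⇒≯ t≤hx)) ⟩
    count S t + 0                  ∎)
    where open ≡-Reasoning

  -- If no element of S has its value in [h x, t), then x raises the count below t
  -- by one; otherwise x bumps such an element and the count is unchanged.
  count-actLetter-< : ∀ x S {t} → h x < t → count (actLetter x S) t ≡ count S t ⊔ suc (count S (h x))
  count-actLetter-< x S {t} hx<t with actLetter x S | actLetter-view x S
  ... | _ | append smaller = begin
    count (S ∪ ⁅ x ⁆) t              ≡⟨ count-insert t (λ x∈S → <-irrefl refl (smaller x x∈S)) ⟩
    count S t + 𝟙 (h x <? t)         ≡⟨ cong (count S t +_) (𝟙-yes _ hx<t) ⟩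
    count S t + 1                    ≡⟨ m≡n⇒m+1≡m⊔1+n gap ⟩
    count S t ⊔ suc (count S (h x))  ∎
    where
    open ≡-Reasoning
    gap : count S t ≡ count S (h x)
    gap = count-gap (<⇒≤ hx<t) λ z z∈S hx≤hz → contradiction (h-increasing (smaller z z∈S)) (≤⇒≯ hx≤hz)
  ... | _ | bump {y} x≤y y∈S least x∉S-y with <-≤-connex (h y) t
  ...   | inj₁ hy<t = +-cancelʳ-≡ _ _ _ (begin
    count ((S - y) ∪ ⁅ x ⁆) t + 1              ≡⟨ cong (count ((S - y) ∪ ⁅ x ⁆) t +_) (𝟙-yes _ hy<t) ⟨
    count ((S - y) ∪ ⁅ x ⁆) t + 𝟙 (h y <? t)   ≡⟨ count-bump t y∈S x∉S-y ⟩
    count S t + 𝟙 (h x <? t)                   ≡⟨ cong (count S t +_) (𝟙-yes _ hx<t) ⟩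
    count S t + 1                              ≡⟨ cong (_+ 1) (m≥n⇒m⊔n≡m (count-< y∈S (h-mono-≤ x≤y) hy<t)) ⟨
    count S t ⊔ suc (count S (h x)) + 1        ∎)
    where open ≡-Reasoning
  ...   | inj₂ t≤hy = +-cancelʳ-≡ _ _ _ (begin
    count ((S - y) ∪ ⁅ x ⁆) t + 0              ≡⟨ cong (count ((S - y) ∪ ⁅ x ⁆) t +_) (𝟙-no _ (≤⇒≯ t≤hy)) ⟨
    count ((S - y) ∪ ⁅ x ⁆) t + 𝟙 (h y <? t)   ≡⟨ count-bump t y∈S x∉S-y ⟩
    count S t + 𝟙 (h x <? t)                   ≡⟨ cong (count S t +_) (𝟙-yes _ hx<t) ⟩
    count S t + 1                              ≡⟨ m≡n⇒m+1≡m⊔1+n gap ⟩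
    count S t ⊔ suc (count S (h x))            ≡⟨ +-identityʳ _ ⟨
    count S t ⊔ suc (count S (h x)) + 0        ∎)
    where
    open ≡-Reasoning
    gap : count S t ≡ count S (h x)
    gap = count-gap (<⇒≤ hx<t) λ z z∈S hx≤hz → ≤-trans t≤hy (h-mono-≤ (least z (h-cancel-≤ hx≤hz) z∈S))

  count-act : ∀ u S t → count (act u S) t ≡ ⨆[ b ≤ t ] (count S b + lds (map h u) b t)
  count-act [] S t = sym (begin
    ⨆[ b ≤ t ] (count S b + 0)  ≡⟨ ⨆-cong t (λ b → +-identityʳ (count S b)) ⟩
    ⨆[ b ≤ t ] count S b        ≡⟨ ≤-antisym (⨆-lub (count S) λ b → count-mono S) (⨆-ub (count S) ≤-refl) ⟩
    count S t                   ∎)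
    where open ≡-Reasoning
  count-act (x ∷ u) S t with ≤-<-connex t (h x)
  ... | inj₁ t≤hx = begin
    count (actLetter x (act u S)) t  ≡⟨ count-actLetter-≥ x (act u S) t≤hx ⟩
    count (act u S) t                ≡⟨ count-act u S t ⟩
    ⨆[ b ≤ t ] (count S b + lds (map h u) b t)        ≡⟨ ⨆-cong t (λ b → cong (count S b +_) (lds-∉ (map h u) λ (_ , hx<t) → ≤⇒≯ t≤hx hx<t)) ⟨
    ⨆[ b ≤ t ] (count S b + lds (map h (x ∷ u)) b t)  ∎
    where open ≡-Reasoning
  ... | inj₂ hx<t = begin
    count (actLetter x (act u S)) t                  ≡⟨ count-actLetter-< x (act u S) hx<t ⟩
    count (act u S) t ⊔ suc (count (act u S) (h x))  ≡⟨ cong₂ (λ m n → m ⊔ suc n) (count-act u S t) (count-act u S (h x)) ⟩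
    ⨆[ b ≤ t ] (count S b + lds (map h u) b t) ⊔ suc (⨆[ b ≤ h x ] (count S b + lds (map h u) b (h x)))
                                                     ≡⟨ ⨆+lds-∷ (count S) (map h u) hx<t ⟩
    ⨆[ b ≤ t ] (count S b + lds (map h (x ∷ u)) b t) ∎
    where open ≡-Reasoning

  count-act-below : ∀ u {b t} → b ≤ t → count (act u (below b)) t ≡ rank b + lds (map h u) b t
  count-act-below u {b} {t} b≤t = trans (count-act u (below b) t) (≤-antisym upper lower)
    where
    L : ℕ → ℕ → ℕ
    L = lds (map h u)
    F : ℕ → ℕ
    F b′ = count (below b) b′ + L b′ t
    upper : ⨆ t F ≤ rank b + L b t
    upper = ⨆-lub F {t} λ b′ _ → begin
      count (below b) b′ + L b′ t   ≡⟨ cong (_+ L b′ t) (count-below b b′) ⟩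
      rank (b′ ⊓ b) + L b′ t        ≤⟨ +-monoʳ-≤ (rank (b′ ⊓ b)) (lds-antitone (map h u) (m⊓n≤m b′ b)) ⟩
      rank (b′ ⊓ b) + L (b′ ⊓ b) t  ≤⟨ rank+lds-mono u (m⊓n≤n b′ b) ⟩
      rank b + L b t                ∎
      where open ≤-Reasoning
    lower : rank b + L b t ≤ ⨆ t F
    lower = begin
      rank b + L b t        ≡⟨ cong (λ c → rank c + L b t) (⊓-idem b) ⟨
      rank (b ⊓ b) + L b t  ≡⟨ cong (_+ L b t) (count-below b b) ⟨
      F b                   ≤⟨ ⨆-ub F b≤t ⟩
      ⨆ t F                 ∎
      where open ≤-Reasoning

  sameAction⇔sameLds : ∀ u v → SameAction u v ⇔ SameLds (map h u) (map h v)
  sameAction⇔sameLds u v = mk⇔ sameAction⇒sameLds sameLds⇒sameAction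
    where
    open ≡-Reasoning
    sameAction⇒sameLds : SameAction u v → SameLds (map h u) (map h v)
    sameAction⇒sameLds same lo hi with ≤-<-connex lo hi
    ... | inj₁ lo≤hi = +-cancelˡ-≡ (rank lo) _ _ (begin
      rank lo + lds (map h u) lo hi  ≡⟨ count-act-below u lo≤hi ⟨
      count (act u (below lo)) hi    ≡⟨ cong (λ γ → count γ hi) (same (below lo)) ⟩
      count (act v (below lo)) hi    ≡⟨ count-act-below v lo≤hi ⟩
      rank lo + lds (map h v) lo hi  ∎)
    ... | inj₂ hi<lo = trans (lds-empty (map h u) (<⇒≤ hi<lo)) (sym (lds-empty (map h v) (<⇒≤ hi<lo)))
    sameLds⇒sameAction : SameLds (map h u) (map h v) → SameAction u v
    sameLds⇒sameAction same γ = count-injective λ t → begin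
      count (act u γ) t                              ≡⟨ count-act u γ t ⟩
      ⨆[ b ≤ t ] (count γ b + lds (map h u) b t)     ≡⟨ ⨆-cong t (λ b → cong (count γ b +_) (same b t)) ⟩
      ⨆[ b ≤ t ] (count γ b + lds (map h v) b t)     ≡⟨ count-act v γ t ⟨
      count (act v γ) t                              ∎

corollary8p4 : (n m : ℕ) (ι : Fin m → Fin n)
  → (∀ i j → i Fin.< j → ι i Fin.< ι j)
  → (u v : List (Fin m))
  → ((∀ (γ : Subset m) → act u γ ≡ act v γ)
      → (∀ (γ : Subset n) → act (map ι u) γ ≡ act (map ι v) γ))
    × ((∀ (γ : Subset n) → act (map ι u) γ ≡ act (map ι v) γ)
      → (∀ (γ : Subset m) → act u γ ≡ act v γ))
corollary8p4 n m ι ι-increasing u v =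
    (λ same → from inA (subst₂ SameLds (map-∘ u) (map-∘ v) (to inB same)))
  , (λ same → from inB (subst₂ SameLds (sym (map-∘ u)) (sym (map-∘ v)) (to inA same)))
  where
  open Equivalence
  inB : SameAction u v ⇔ SameLds (map (Fin.toℕ ∘ ι) u) (map (Fin.toℕ ∘ ι) v)
  inB = Counting.sameAction⇔sameLds (Fin.toℕ ∘ ι) (ι-increasing _ _) u v
  inA : SameAction (map ι u) (map ι v) ⇔ SameLds (map Fin.toℕ (map ι u)) (map Fin.toℕ (map ι v))
  inA = Counting.sameAction⇔sameLds Fin.toℕ (λ i<j → i<j) (map ι u) (map ι v)
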